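{- Let $a\in\mathbb{Z}_{\geq1}$ and let $m\ge4$ be an integer with $m\not\equiv 3\pmod{2a+1}$. Let $r_a=\big\lfloor\frac{am-(a-1)}{2a+1}\big\rfloor+1$. Then $$\sum_{i=0}^{r_a-1}\binom{m}{i}a^i<\binom{m}{r_a}a^{r_a-1}.$$ -}

module Defs where

open import Data.Nat using (ℕ; zero; suc; _+_; _*_; _∸_; _^_)
open import Data.Nat.DivMod using (_/_)
open import Data.Nat.Combinatorics using (_C_)

sumBelow : ℕ → (ℕ → ℕ) → ℕ
sumBelow zero    f = 0
sumBelow (suc n) f = sumBelow n f + f n

-- r_a = ⌊(a m - (a - 1)) / (2a+1)⌋ + 1   (numerator is ≥ 0 since m ≥ 1)
r : ℕ → ℕ → ℕ
r a m = (a * m ∸ (a ∸ 1)) / suc (2 * a) + 1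

{-# OPTIONS --safe #-}
module Submission where

open import Defs
open import Data.Nat
open import Data.Nat.Properties
open import Data.Nat.DivMod using (_/_; _%_; m≡m%n+[m/n]*n; [m+kn]%n≡m%n; m/n*n≡m)
open import Data.Nat.Combinatorics
  using (_C_; nCk≡n!/k![n-k]!; k![n∸k]!∣n!; [n-k]*[n-k-1]!≡[n-k]!)
open import Data.Empty using (⊥-elim)
open import Relation.Nullary using (Dec; yes; no)
open import Relation.Binary.PropositionalEquality
open import Data.Nat.Tactic.RingSolver using (solve-∀)

-- With q = r_a - 1, the terms t_i = C(m,i) a^i satisfy t_{i+1}/t_i = a(m-i)/(i+1), so for
-- i < q the ratio t_i/t_{i+1} is at most q/D with D = a(m-q+1). Comparing with a geometric
-- series gives Σ_{i≤q} t_i ≤ t_q D/(D-q), and the defining inequality q(2a+1) + a ≤ am of q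
-- (the case of equality, am - (a-1) = q(2a+1), is exactly m ≡ 3 mod 2a+1) makes this
-- smaller than t_{q+1}/a = C(m,q+1) a^q.

nCk*k![n∸k]!≡n! : ∀ {n k} → k ≤ n → (n C k) * (k ! * (n ∸ k) !) ≡ n !
nCk*k![n∸k]!≡n! {n} {k} k≤n =
  trans (cong (_* (k ! * (n ∸ k) !)) (nCk≡n!/k![n-k]! k≤n)) (m/n*n≡m (k![n∸k]!∣n! k≤n))
  where instance _ = k !* (n ∸ k) !≢0

nCk>0 : ∀ {n k} → k ≤ n → 0 < n C k
nCk>0 {n} {k} k≤n = n≢0⇒n>0 λ nCk≡0 → ≢-nonZero⁻¹ (n !) {{n !≢0}}
  (trans (sym (nCk*k![n∸k]!≡n! k≤n)) (cong (_* (k ! * (n ∸ k) !)) nCk≡0))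

nC[1+k]*[1+k]≡nCk*[n∸k] : ∀ {n k} → k < n → (n C suc k) * suc k ≡ (n C k) * (n ∸ k)
nC[1+k]*[1+k]≡nCk*[n∸k] {n} {k} k<n = *-cancelʳ-≡ _ _ d {{k !* (n ∸ suc k) !≢0}} (begin
  (n C suc k) * suc k * d                         ≡⟨ regroupˡ (n C suc k) (suc k) (k !) ((n ∸ suc k) !) ⟩
  (n C suc k) * (suc k ! * (n ∸ suc k) !)         ≡⟨ nCk*k![n∸k]!≡n! k<n ⟩
  n !                                           ≡⟨ nCk*k![n∸k]!≡n! (<⇒≤ k<n) ⟨
  (n C k) * (k ! * (n ∸ k) !)                     ≡⟨ cong (λ x → (n C k) * (k ! * x)) ([n-k]*[n-k-1]!≡[n-k]! k<n) ⟨
  (n C k) * (k ! * ((n ∸ k) * (n ∸ suc k) !))     ≡⟨ regroupʳ (n C k) (k !) (n ∸ k) ((n ∸ suc k) !) ⟩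
  (n C k) * (n ∸ k) * d                           ∎)
  where
  open ≡-Reasoning
  d = k ! * (n ∸ suc k) !
  regroupˡ : ∀ c s f g → c * s * (f * g) ≡ c * (s * f * g)
  regroupˡ = solve-∀
  regroupʳ : ∀ c f e g → c * (f * (e * g)) ≡ c * e * (f * g)
  regroupʳ = solve-∀

≤-by-ratio : ∀ {x y s c d e} .{{_ : NonZero c}} → y * s ≡ x * c → s ≤ d → e ≤ c → x * e ≤ y * d
≤-by-ratio {x} {y} {s} {c} {d} {e} y*s≡x*c s≤d e≤c = *-cancelʳ-≤ (x * e) (y * d) c (begin
  x * e * c    ≡⟨ swap x e c ⟩
  x * c * e    ≡⟨ cong (_* e) y*s≡x*c ⟨
  y * s * e    ≡⟨ *-assoc y s e ⟩
  y * (s * e)  ≤⟨ *-monoʳ-≤ y (*-mono-≤ s≤d e≤c) ⟩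
  y * (d * c)  ≡⟨ *-assoc y d c ⟨
  y * d * c    ∎)
  where
  open ≤-Reasoning
  swap : ∀ x e c → x * e * c ≡ x * c * e
  swap = solve-∀

sumBelow-geometric : ∀ (t : ℕ → ℕ) {c d} n → d ≤ c →
  (∀ k → k < n → t k * c ≤ t (suc k) * d) →
  sumBelow (suc n) t * (c ∸ d) ≤ t n * c
sumBelow-geometric t {c} {d} zero d≤c ratio = *-monoʳ-≤ (t 0) (m∸n≤m c d)
sumBelow-geometric t {c} {d} (suc n) d≤c ratio = begin
  (sumBelow (suc n) t + t (suc n)) * (c ∸ d)          ≡⟨ *-distribʳ-+ (c ∸ d) (sumBelow (suc n) t) (t (suc n)) ⟩
  sumBelow (suc n) t * (c ∸ d) + t (suc n) * (c ∸ d)  ≤⟨ +-monoˡ-≤ (t (suc n) * (c ∸ d)) (≤-trans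
                                                         (sumBelow-geometric t n d≤c (λ k k<n → ratio k (m<n⇒m<1+n k<n)))
                                                         (ratio n (n<1+n n))) ⟩
  t (suc n) * d + t (suc n) * (c ∸ d)                 ≡⟨ *-distribˡ-+ (t (suc n)) d (c ∸ d) ⟨
  t (suc n) * (d + (c ∸ d))                           ≡⟨ cong (t (suc n) *_) (m+[n∸m]≡n d≤c) ⟩
  t (suc n) * c                                       ∎
  where open ≤-Reasoning

binomialTerm : ℕ → ℕ → ℕ → ℕ
binomialTerm a m i = (m C i) * a ^ i

binomialTerm-ratio : ∀ a {m k} → k < m →
  binomialTerm a m (suc k) * suc k ≡ binomialTerm a m k * (a * (m ∸ k))
binomialTerm-ratio a {m} {k} k<m = begin
  (m C suc k) * (a * a ^ k) * suc k  ≡⟨ regroupˡ (m C suc k) a (a ^ k) (suc k) ⟩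
  (m C suc k) * suc k * a ^ k * a    ≡⟨ cong (λ x → x * a ^ k * a) (nC[1+k]*[1+k]≡nCk*[n∸k] k<m) ⟩
  (m C k) * (m ∸ k) * a ^ k * a      ≡⟨ regroupʳ (m C k) (m ∸ k) a (a ^ k) ⟩
  (m C k) * a ^ k * (a * (m ∸ k))    ∎
  where
  open ≡-Reasoning
  regroupˡ : ∀ c a p s → c * (a * p) * s ≡ c * s * p * a
  regroupˡ = solve-∀
  regroupʳ : ∀ c e a p → c * e * p * a ≡ c * p * (a * e)
  regroupʳ = solve-∀

binomialTerm-ratio-≤ : ∀ a {m q k} .{{_ : NonZero a}} → q < m → k < q →
  binomialTerm a m k * (a * suc (m ∸ q)) ≤ binomialTerm a m (suc k) * q
binomialTerm-ratio-≤ a {m} {q} {k} q<m k<q =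
  ≤-by-ratio {binomialTerm a m k} {binomialTerm a m (suc k)} {{m*n≢0 a (m ∸ k)}}
    (binomialTerm-ratio a k<m) k<q (*-monoʳ-≤ a suc[m∸q]≤m∸k)
  where
  k<m : k < m
  k<m = <-trans k<q q<m
  instance _ = ≢-nonZero (m>n⇒m∸n≢0 k<m)
  suc[m∸q]≤m∸k : suc (m ∸ q) ≤ m ∸ k
  suc[m∸q]≤m∸k = ≤-trans (s≤s (∸-monoʳ-≤ m k<q)) (≤-reflexive (sym (+-∸-assoc 1 k<m)))

a*sumBelow<binomialTerm : ∀ a {m q} .{{_ : NonZero a}} → q < m → q ≤ a * suc (m ∸ q) →
  suc q * (a * suc (m ∸ q)) < (m ∸ q) * (a * suc (m ∸ q) ∸ q) →
  a * sumBelow (suc q) (binomialTerm a m) < binomialTerm a m (suc q)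
a*sumBelow<binomialTerm a {m} {q} q<m q≤D D-bound = *-cancelʳ-< (E * u) (a * S) (t (suc q)) (begin-strict
  a * S * (E * u)          ≡⟨ regroup a S E u ⟩
  S * E * (a * u)          ≤⟨ *-monoˡ-≤ (a * u)
                                (sumBelow-geometric t q q≤D (λ k → binomialTerm-ratio-≤ a q<m)) ⟩
  t q * D * (a * u)        ≡⟨ swap (t q) D (a * u) ⟩
  t q * (a * u) * D        ≡⟨ cong (_* D) (binomialTerm-ratio a q<m) ⟨
  t (suc q) * suc q * D    ≡⟨ *-assoc (t (suc q)) (suc q) D ⟩
  t (suc q) * (suc q * D)  <⟨ *-monoʳ-< (t (suc q)) D-bound ⟩
  t (suc q) * (u * E)      ≡⟨ cong (t (suc q) *_) (*-comm u E) ⟩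
  t (suc q) * (E * u)      ∎)
  where
  open ≤-Reasoning
  t = binomialTerm a m
  S = sumBelow (suc q) t
  u = m ∸ q
  D = a * suc u
  E = D ∸ q
  instance
    _ : NonZero (t (suc q))
    _ = m*n≢0 (m C suc q) (a ^ suc q) {{>-nonZero (nCk>0 q<m)}} {{m^n≢0 a (suc q)}}
  regroup : ∀ a s e u → a * s * (e * u) ≡ s * e * (a * u)
  regroup = solve-∀
  swap : ∀ x y z → x * y * z ≡ x * z * y
  swap = solve-∀

m%n≢0⇒m/n*n<m : ∀ m n .{{_ : NonZero n}} → m % n ≢ 0 → m / n * n < m
m%n≢0⇒m/n*n<m m n m%n≢0 = begin-strict
  m / n * n            <⟨ m<n+m (m / n * n) (n≢0⇒n>0 m%n≢0) ⟩
  m % n + m / n * n    ≡⟨ m≡m%n+[m/n]*n m n ⟨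
  m                    ∎
  where open ≤-Reasoning

am≡q[2a+1]+[a∸1]⇒m≡3 : ∀ a {m q} .{{_ : NonZero a}} →
  a * m ≡ q * suc (2 * a) + (a ∸ 1) → m % suc (2 * a) ≡ 3 % suc (2 * a)
am≡q[2a+1]+[a∸1]⇒m≡3 a@(suc b) {m} {q} am≡ = begin
  m % N                        ≡⟨ [m+kn]%n≡m%n m (2 * q + 1) N ⟨
  (m + (2 * q + 1) * N) % N    ≡⟨ cong (_% N) m+[2q+1]N≡3+mN ⟩
  (3 + m * N) % N              ≡⟨ [m+kn]%n≡m%n 3 m N ⟩
  3 % N                        ∎
  where
  open ≡-Reasoning
  N = suc (2 * a)
  expandˡ : ∀ b m q → m + (2 * q + 1) * suc (2 * suc b) ≡ 3 + m + 2 * (q * suc (2 * suc b) + b)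
  expandˡ = solve-∀
  expandʳ : ∀ b m → 3 + m + 2 * (suc b * m) ≡ 3 + m * suc (2 * suc b)
  expandʳ = solve-∀
  m+[2q+1]N≡3+mN : m + (2 * q + 1) * N ≡ 3 + m * N
  m+[2q+1]N≡3+mN = begin
    m + (2 * q + 1) * N          ≡⟨ expandˡ b m q ⟩
    3 + m + 2 * (q * N + b)      ≡⟨ cong (λ x → 3 + m + 2 * x) am≡ ⟨
    3 + m + 2 * (a * m)          ≡⟨ expandʳ b m ⟩
    3 + m * N                    ∎

floor-bound : ∀ a {m} .{{_ : NonZero a}} → 1 ≤ m → m % suc (2 * a) ≢ 3 % suc (2 * a) →
  (a * m ∸ (a ∸ 1)) / suc (2 * a) * suc (2 * a) + a ≤ a * m
floor-bound a@(suc b) {m} 1≤m m≢3 = bound (x % N ≟ 0)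
  where
  N = suc (2 * a)
  x = a * m ∸ b
  q = x / N
  x+b≡am : x + b ≡ a * m
  x+b≡am = m∸n+n≡m (≤-trans (n≤1+n b) (m≤m*n a m {{>-nonZero 1≤m}}))
  bound : Dec (x % N ≡ 0) → q * N + a ≤ a * m
  bound (yes x%N≡0) = ⊥-elim (m≢3 (am≡q[2a+1]+[a∸1]⇒m≡3 a {q = q} (begin
    a * m              ≡⟨ x+b≡am ⟨
    x + b              ≡⟨ cong (_+ b) (m≡m%n+[m/n]*n x N) ⟩
    x % N + q * N + b  ≡⟨ cong (λ r → r + q * N + b) x%N≡0 ⟩
    q * N + b          ∎)))
    where open ≡-Reasoning
  bound (no x%N≢0) = begin
    q * N + suc b      ≡⟨ +-suc (q * N) b ⟩
    suc (q * N) + b    ≤⟨ +-monoˡ-≤ b (m%n≢0⇒m/n*n<m x N x%N≢0) ⟩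
    x + b              ≡⟨ x+b≡am ⟩
    a * m              ∎
    where open ≤-Reasoning

q[2a+1]+a≤am⇒q<m : ∀ a {m q} .{{_ : NonZero a}} → q * suc (2 * a) + a ≤ a * m → q < m
q[2a+1]+a≤am⇒q<m a {m} {q} H = *-cancelʳ-< (suc (2 * a)) q m (begin-strict
  q * suc (2 * a)       <⟨ m<m+n (q * suc (2 * a)) (>-nonZero⁻¹ a) ⟩
  q * suc (2 * a) + a   ≤⟨ H ⟩
  a * m                 ≤⟨ *-monoˡ-≤ m (≤-trans (m≤m+n a (a + 0)) (n≤1+n (2 * a))) ⟩
  suc (2 * a) * m       ≡⟨ *-comm (suc (2 * a)) m ⟩
  m * suc (2 * a)       ∎)
  where open ≤-Reasoning

q[2a+1]+a≤am⇒q[a+1]+a≤a[m∸q] : ∀ a {m q} → q ≤ m →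
  q * suc (2 * a) + a ≤ a * m → q * suc a + a ≤ a * (m ∸ q)
q[2a+1]+a≤am⇒q[a+1]+a≤a[m∸q] a {m} {q} q≤m H = +-cancelʳ-≤ (a * q) (q * suc a + a) (a * (m ∸ q)) (begin
  q * suc a + a + a * q   ≡⟨ regroup a q ⟩
  q * suc (2 * a) + a     ≤⟨ H ⟩
  a * m                   ≡⟨ cong (a *_) (m∸n+n≡m q≤m) ⟨
  a * (m ∸ q + q)         ≡⟨ *-distribˡ-+ a (m ∸ q) q ⟩
  a * (m ∸ q) + a * q     ∎)
  where
  open ≤-Reasoning
  regroup : ∀ a q → q * suc a + a + a * q ≡ q * suc (2 * a) + a
  regroup = solve-∀

q[a+1]+a≤au⇒q≤a[1+u] : ∀ a {q u} → q * suc a + a ≤ a * u → q ≤ a * suc u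
q[a+1]+a≤au⇒q≤a[1+u] a {q} {u} H = begin
  q              ≤⟨ m≤m*n q (suc a) ⟩
  q * suc a      ≤⟨ m≤m+n (q * suc a) a ⟩
  q * suc a + a  ≤⟨ H ⟩
  a * u          ≤⟨ *-monoʳ-≤ a (n≤1+n u) ⟩
  a * suc u      ∎
  where open ≤-Reasoning

q[a+1]+a≤a[m∸q]⇒1<m∸q : ∀ a {m} q .{{_ : NonZero a}} → 1 < m →
  q * suc a + a ≤ a * (m ∸ q) → 1 < m ∸ q
q[a+1]+a≤a[m∸q]⇒1<m∸q a zero 1<m _ = 1<m
q[a+1]+a≤a[m∸q]⇒1<m∸q a {m} (suc q) _ H = *-cancelˡ-< a 1 (m ∸ suc q) (begin-strict
  a * 1                  ≡⟨ *-identityʳ a ⟩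
  a                      <⟨ m<n+m a z<s ⟩
  suc q * suc a + a      ≤⟨ H ⟩
  a * (m ∸ suc q)        ∎)
  where open ≤-Reasoning

q[a+1]+a≤au⇒[1+q]D<u[D∸q] : ∀ a {q u} .{{_ : NonZero a}} → q * suc a + a ≤ a * u → 1 < u →
  suc q * (a * suc u) < u * (a * suc u ∸ q)
q[a+1]+a≤au⇒[1+q]D<u[D∸q] a {zero} {u} _ 1<u = begin-strict
  a * suc u + 0    ≡⟨ +-identityʳ (a * suc u) ⟩
  a * suc u        <⟨ m<m*n (a * suc u) u {{m*n≢0 a (suc u)}} 1<u ⟩
  a * suc u * u    ≡⟨ *-comm (a * suc u) u ⟩
  u * (a * suc u)  ∎
  where open ≤-Reasoning
q[a+1]+a≤au⇒[1+q]D<u[D∸q] a {q@(suc _)} {u} H _ = begin-strict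
  suc q * D                  <⟨ m+n≤o⇒m≤o∸n (suc (suc q * D)) (begin-strict
                                  suc q * D + u * q        <⟨ +-monoʳ-< (suc q * D) (m<n+m (u * q) z<s) ⟩
                                  suc q * D + suc u * q    ≡⟨ expand a q u ⟨
                                  suc u * (q * suc a + a)  ≤⟨ *-monoʳ-≤ (suc u) H ⟩
                                  suc u * (a * u)          ≡⟨ swap a u ⟩
                                  u * D                    ∎) ⟩
  u * D ∸ u * q              ≡⟨ *-distribˡ-∸ u D q ⟨
  u * (D ∸ q)                ∎
  where
  open ≤-Reasoning
  D = a * suc u
  expand : ∀ a q u → suc u * (q * suc a + a) ≡ suc q * (a * suc u) + suc u * q
  expand = solve-∀
  swap : ∀ a u → suc u * (a * u) ≡ u * (a * suc u)
  swap = solve-∀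

lemma3p4 : (a m : ℕ) → 1 ≤ a → 4 ≤ m → m % suc (2 * a) ≢ 3 % suc (2 * a) →
    sumBelow (r a m) (λ i → (m C i) * a ^ i) < (m C r a m) * a ^ (r a m ∸ 1)
lemma3p4 a m 1≤a 4≤m m≢3 =
  subst (λ k → sumBelow k (binomialTerm a m) < (m C k) * a ^ (k ∸ 1)) (+-comm 1 q)
    (*-cancelˡ-< a _ _ (begin-strict
      a * sumBelow (suc q) (binomialTerm a m)  <⟨ a*sumBelow<binomialTerm a q<m
                                                    (q[a+1]+a≤au⇒q≤a[1+u] a {q} shifted)
                                                    (q[a+1]+a≤au⇒[1+q]D<u[D∸q] a {q} shifted 1<m∸q) ⟩
      (m C suc q) * (a * a ^ q)                ≡⟨ pull (m C suc q) a (a ^ q) ⟩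
      a * ((m C suc q) * a ^ q)                ∎))
  where
  open ≤-Reasoning
  instance _ = >-nonZero 1≤a
  q = (a * m ∸ (a ∸ 1)) / suc (2 * a)
  floor : q * suc (2 * a) + a ≤ a * m
  floor = floor-bound a (≤-trans (s≤s z≤n) 4≤m) m≢3
  q<m : q < m
  q<m = q[2a+1]+a≤am⇒q<m a floor
  shifted : q * suc a + a ≤ a * (m ∸ q)
  shifted = q[2a+1]+a≤am⇒q[a+1]+a≤a[m∸q] a (<⇒≤ q<m) floor
  1<m∸q : 1 < m ∸ q
  1<m∸q = q[a+1]+a≤a[m∸q]⇒1<m∸q a q (≤-trans (s≤s (s≤s z≤n)) 4≤m) shifted
  pull : ∀ c a p → c * (a * p) ≡ a * (c * p)
  pull = solve-∀
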